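{- Let $G$ be a graph and $p$ a non-negative integer. For any minimal $K_p$-induced minor structure of $G$, each bag induces a subgraph of $G$ of diameter at most $\max\{{\rm chord}(G)-3,0\}$.
   Context: All graphs are finite, simple and undirected. The chordality ${\rm chord}(G)$ of $G$ is the length of a longest induced cycle of $G$ (and $0$ if $G$ has no cycles). Two disjoint vertex sets $X,Y$ are adjacent if some vertex of $X$ is adjacent to some vertex of $Y$. A $K_p$-induced minor structure of $G$ is a family $\mathcal{W}=\{W(x)\mid x\in V(K_p)\}$ of pairwise disjoint nonempty subsets of $V(G)$ (called bags; not necessarily covering $V(G)$) such that each $G[W(x)]$ is connected and every two distinct bags are adjacent. Such a structure is minimal if there is no $K_p$-induced minor structure $\{W'(x)\mid x\in V(K_p)\}$ with $W'(x)\subseteq W(x)$ for all $x$ and at least one inclusion proper. The diameter of a graph is the maximum distance between two of its vertices. -}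

module Defs where

open import Data.Nat using (ℕ; zero; suc; _≤_; _∸_)
open import Data.Bool using (Bool; true; false)
open import Data.Fin using (Fin; toℕ)
open import Data.Fin.Subset using (Subset; _∈_; _⊆_; _⊂_)
open import Data.Product using (Σ; ∃; _×_; _,_)
open import Data.Sum using (_⊎_)
open import Data.Empty using (⊥)
open import Relation.Nullary using (¬_)
open import Relation.Binary.PropositionalEquality using (_≡_; _≢_)
open import Function.Definitions using (Injective)

record Graph : Set where
  field
    n     : ℕ
    adj   : Fin n → Fin n → Bool
    sym   : ∀ u v → adj u v ≡ adj v u
    irrefl : ∀ v → adj v v ≡ false

open Graph public

Adj : (G : Graph) → Fin (n G) → Fin (n G) → Set
Adj G u v = adj G u v ≡ true

CycNbr : {k : ℕ} → Fin k → Fin k → Set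
CycNbr {k} i j =
    suc (toℕ i) ≡ toℕ j
  ⊎ suc (toℕ j) ≡ toℕ i
  ⊎ (toℕ i ≡ 0 × suc (toℕ j) ≡ k)
  ⊎ (toℕ j ≡ 0 × suc (toℕ i) ≡ k)

InducedCycle : Graph → ℕ → Set
InducedCycle G k =
  3 ≤ k × Σ (Fin k → Fin (n G)) λ c →
    Injective _≡_ _≡_ c × (∀ i j → (Adj G (c i) (c j) → CycNbr i j)
                                 × (CycNbr i j → Adj G (c i) (c j)))

IsChordality : Graph → ℕ → Set
IsChordality G m =
  (∀ k → InducedCycle G k → k ≤ m) × (m ≡ 0 ⊎ InducedCycle G m)

data WalkIn (G : Graph) (S : Subset (n G)) : Fin (n G) → Fin (n G) → ℕ → Set where
  here : ∀ {v} → v ∈ S → WalkIn G S v v 0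
  step : ∀ {u w v ℓ} → u ∈ S → Adj G u w → WalkIn G S w v ℓ → WalkIn G S u v (suc ℓ)

ConnectedIn : (G : Graph) → Subset (n G) → Set
ConnectedIn G S = ∀ u v → u ∈ S → v ∈ S → ∃ λ ℓ → WalkIn G S u v ℓ

DistIn≤ : (G : Graph) → Subset (n G) → Fin (n G) → Fin (n G) → ℕ → Set
DistIn≤ G S u v d = ∃ λ ℓ → ℓ ≤ d × WalkIn G S u v ℓ

DiameterIn≤ : (G : Graph) → Subset (n G) → ℕ → Set
DiameterIn≤ G S d = ∀ u v → u ∈ S → v ∈ S → DistIn≤ G S u v d

SetsAdjacent : (G : Graph) → Subset (n G) → Subset (n G) → Set
SetsAdjacent G X Y = ∃ λ u → ∃ λ v → u ∈ X × v ∈ Y × Adj G u v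

IsKpStructure : (G : Graph) (p : ℕ) → (Fin p → Subset (n G)) → Set
IsKpStructure G p W =
    (∀ x → ∃ λ v → v ∈ W x)
  × (∀ x y → x ≢ y → ∀ v → v ∈ W x → v ∈ W y → ⊥)
  × (∀ x → ConnectedIn G (W x))
  × (∀ x y → x ≢ y → SetsAdjacent G (W x) (W y))

IsMinimalKpStructure : (G : Graph) (p : ℕ) → (Fin p → Subset (n G)) → Set
IsMinimalKpStructure G p W =
  IsKpStructure G p W ×
  (∀ (W' : Fin p → Subset (n G)) → IsKpStructure G p W' →
     (∀ x → W' x ⊆ W x) → ¬ (∃ λ x → W' x ⊂ W x))

-- Let d ≥ 1 be the distance of two vertices in G[W x]. A vertex a farthest from one of
-- them, and a vertex b farthest from a, span a geodesic a ⋯ b of length D ≥ d, and neither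
-- a nor b is a cut vertex of G[W x]. By minimality, W x - a cannot replace W x, so some bag
-- W y touches W x only at a; likewise some bag W z touches W x only at b. A shortest walk
-- in W y ∪ W z from a neighbour of b to a neighbour of a has length at least 1 and closes
-- the geodesic into an induced cycle of length at least D + 3, so d + 3 ≤ chord(G).

module Submission where

open import Defs
open import Data.Nat using (ℕ; zero; suc; _+_; _∸_; _≤_; _<_; z≤n; s≤s; _≤?_)
open import Data.Nat.Properties
  using ( +-comm; ≮⇒≥; m+[n∸m]≡n; +-monoˡ-<; ≤-trans; <⇒≤; +-suc; n≤1+n; <-cmp
        ; m≤n⇒m<n∨m≡n; <-≤-trans; <⇒≱; m≤m+n; m+n∸m≡n; ≰⇒>; ≤-pred; m<n+o⇒m∸n<o; <⇒≢
        ; ≤-<-trans; m<m+n; +-cancelˡ-≡; +-identityʳ; suc-injective; ∸-monoʳ-<; ≤-refl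
        ; m≤n+m; +-monoʳ-≤; +-monoˡ-≤; m+n≤o⇒m≤o∸n
        )
open import Data.Fin using (Fin; toℕ; zero; suc; _≟_)
open import Data.Fin.Properties using (any?; all?; ¬∀⟶∃¬; toℕ-injective; toℕ<n)
import Data.Bool as Bool
open import Data.Vec.Functional using (updateAt)
open import Data.Vec.Functional.Properties using (updateAt-updates; updateAt-minimal)
open import Data.Fin.Subset using (Subset; _∈_; _∉_; _⊆_; _⊂_; _∪_; _-_)
open import Data.Fin.Subset.Properties using (_∈?_; x∈p∪q⁻; x∈p∪q⁺; x∈p∧x≢y⇒x∈p-y; x∈p⇒p-x⊂p; p─q⊆p)
open import Data.List using (filter; allFin)
open import Data.List.Extrema.Nat using (argmax; argmax-all; f[xs]≤f[argmax])
open import Data.List.Membership.Propositional.Properties using (∈-filter⁺; ∈-allFin)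
open import Data.List.Relation.Unary.All.Properties using (all-filter)
import Data.List.Relation.Unary.All as All
open import Data.Vec using (_∷_; here; there)
open import Data.Product using (∃; ∃₂; _×_; _,_; proj₁; proj₂)
open import Relation.Binary using (tri<; tri≈; tri>)
open import Data.Sum using (_⊎_; inj₁; inj₂)
open import Data.Empty using (⊥; ⊥-elim)
open import Relation.Unary using (Decidable)
open import Relation.Nullary using (¬_; Dec; yes; no; contradiction; ¬?)
open import Relation.Nullary.Decidable using (_×-dec_; _→-dec_)
import Relation.Nullary.Decidable as Dec
open import Relation.Binary.PropositionalEquality using (_≡_; _≢_; refl; trans; cong; subst; subst₂)
import Relation.Binary.PropositionalEquality as ≡

minimal-witness : {P : ℕ → Set} → Decidable P → ∀ {ℓ} → P ℓ →
                  ∃ λ k → P k × (∀ {j} → j < k → ¬ P j)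
minimal-witness P? {zero} Pℓ = 0 , Pℓ , λ ()
minimal-witness P? {suc ℓ} Pℓ with P? 0
... | yes P0 = 0 , P0 , λ ()
... | no ¬P0 with minimal-witness (λ k → P? (suc k)) Pℓ
... | k , Pk , below = suc k , Pk , λ { {zero} _ → ¬P0 ; {suc j} (s≤s j<k) → below j<k }

shortcut-shorter : ∀ {i j ℓ} → i < j → j ≤ ℓ → i + (ℓ ∸ j) < ℓ
shortcut-shorter {i} {j} {ℓ} i<j j≤ℓ = subst (i + (ℓ ∸ j) <_) (m+[n∸m]≡n j≤ℓ) (+-monoˡ-< (ℓ ∸ j) i<j)

argmax-over : ∀ {m} (f : Fin m → ℕ) {P : Fin m → Set} → Decidable P → ∃ P →
              ∃ λ w → P w × (∀ {w′} → P w′ → f w′ ≤ f w)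
argmax-over {m} f P? (a , Pa) =
    argmax f a xs
  , argmax-all f Pa (all-filter P? (allFin m))
  , λ Pw′ → All.lookup (f[xs]≤f[argmax] a xs) (∈-filter⁺ P? (∈-allFin _) Pw′)
  where xs = filter P? (allFin m)

x∉p-x : ∀ {m} {p : Subset m} (x : Fin m) → x ∉ p - x
x∉p-x {p = _ ∷ _} zero ()
x∉p-x {p = _ ∷ p} (suc x) (there h) = x∉p-x {p = p} x h

x∈p-y⇒x≢y : ∀ {m} {p : Subset m} {x y : Fin m} → x ∈ p - y → x ≢ y
x∈p-y⇒x≢y {y = y} x∈ refl = x∉p-x y x∈

updateAt-cases : ∀ {A : Set} {p} (W : Fin p → A) x (f : A → A) y →
                 (y ≡ x × updateAt W x f y ≡ f (W x)) ⊎ (y ≢ x × updateAt W x f y ≡ W y)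
updateAt-cases W x f y with y ≟ x
... | yes refl = inj₁ (refl , updateAt-updates x W)
... | no y≢x = inj₂ (y≢x , updateAt-minimal y x W y≢x)

updateAt-shrinks : ∀ {m p} (W : Fin p → Subset m) x {u} y → updateAt W x (_- u) y ⊆ W y
updateAt-shrinks W x {u} y {w} w∈ with updateAt-cases W x (_- u) y
... | inj₁ (refl , eq) = p─q⊆p (W x) _ (subst (w ∈_) eq w∈)
... | inj₂ (_ , eq) = subst (w ∈_) eq w∈

CycNbrℕ : ℕ → ℕ → ℕ → Set
CycNbrℕ K i j = suc i ≡ j ⊎ suc j ≡ i ⊎ (i ≡ 0 × suc j ≡ K) ⊎ (j ≡ 0 × suc i ≡ K)

CycNbrℕ-sym : ∀ {K i j} → CycNbrℕ K i j → CycNbrℕ K j i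
CycNbrℕ-sym (inj₁ e) = inj₂ (inj₁ e)
CycNbrℕ-sym (inj₂ (inj₁ e)) = inj₁ e
CycNbrℕ-sym (inj₂ (inj₂ (inj₁ e))) = inj₂ (inj₂ (inj₂ e))
CycNbrℕ-sym (inj₂ (inj₂ (inj₂ e))) = inj₂ (inj₂ (inj₁ e))

module InGraph (G : Graph) where

  V : Set
  V = Fin (n G)

  private variable
    S T : Subset (n G)
    u v w : V
    i j k ℓ : ℕ

  Adj-sym : Adj G u v → Adj G v u
  Adj-sym {u} {v} e = trans (Graph.sym G v u) e

  Adj-irrefl : ¬ Adj G v v
  Adj-irrefl {v} e with trans (≡.sym (irrefl G v)) e
  ... | ()

  Adj? : ∀ u v → Dec (Adj G u v)
  Adj? u v = adj G u v Bool.≟ Bool.true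

  SetsAdjacent? : ∀ X Y → Dec (SetsAdjacent G X Y)
  SetsAdjacent? X Y = any? λ a → any? λ b → a ∈? X ×-dec b ∈? Y ×-dec Adj? a b

  walk-source : WalkIn G S u v ℓ → u ∈ S
  walk-source (here u∈) = u∈
  walk-source (step u∈ _ _) = u∈

  walk-target : WalkIn G S u v ℓ → v ∈ S
  walk-target (here v∈) = v∈
  walk-target (step _ _ p) = walk-target p

  walk-zero : WalkIn G S u v 0 → u ≡ v
  walk-zero (here _) = refl

  walk-mono : S ⊆ T → WalkIn G S u v ℓ → WalkIn G T u v ℓ
  walk-mono S⊆T (here u∈) = here (S⊆T u∈)
  walk-mono S⊆T (step u∈ e p) = step (S⊆T u∈) e (walk-mono S⊆T p)

  infixr 5 _++ʷ_
  _++ʷ_ : WalkIn G S u v k → WalkIn G S v w ℓ → WalkIn G S u w (k + ℓ)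
  here _ ++ʷ q = q
  step u∈ e p ++ʷ q = step u∈ e (p ++ʷ q)

  walk-reverse : WalkIn G S u v ℓ → WalkIn G S v u ℓ
  walk-reverse (here v∈) = here v∈
  walk-reverse (step {ℓ = ℓ} u∈ e p) =
    subst (WalkIn G _ _ _) (+-comm ℓ 1) (walk-reverse p ++ʷ step (walk-source p) (Adj-sym e) (here u∈))

  walk? : ∀ S u v ℓ → Dec (WalkIn G S u v ℓ)
  walk? S u v zero with u ≟ v | u ∈? S
  ... | yes refl | yes u∈ = yes (here u∈)
  ... | yes refl | no u∉ = no λ { (here u∈) → u∉ u∈ }
  ... | no u≢v | _ = no λ { (here _) → u≢v refl }
  walk? S u v (suc ℓ) =
    Dec.map′ (λ { (u∈ , _ , e , p) → step u∈ e p }) (λ { (step u∈ e p) → u∈ , _ , e , p })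
             (u ∈? S ×-dec any? λ w → Adj? u w ×-dec walk? S w v ℓ)

  -- Past the end of p, p ! k stays at the last vertex.
  infixl 9 _!_
  _!_ : WalkIn G S u v ℓ → ℕ → V
  _!_ {u = u} _ zero = u
  here {v} _ ! suc _ = v
  step _ _ p ! suc k = p ! k

  !-∈ : (p : WalkIn G S u v ℓ) → ∀ k → p ! k ∈ S
  !-∈ p zero = walk-source p
  !-∈ (here v∈) (suc k) = v∈
  !-∈ (step _ _ p) (suc k) = !-∈ p k

  !-adj : (p : WalkIn G S u v ℓ) → k < ℓ → Adj G (p ! k) (p ! suc k)
  !-adj {k = zero} (step _ e _) _ = e
  !-adj {k = suc k} (step _ _ p) (s≤s k<ℓ) = !-adj p k<ℓ

  !-last : (p : WalkIn G S u v ℓ) → p ! ℓ ≡ v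
  !-last (here _) = refl
  !-last (step _ _ p) = !-last p

  prefix : (p : WalkIn G S u v ℓ) → i ≤ ℓ → WalkIn G S u (p ! i) i
  prefix p z≤n = here (walk-source p)
  prefix (step u∈ e p) (s≤s i≤ℓ) = step u∈ e (prefix p i≤ℓ)

  suffix : (p : WalkIn G S u v ℓ) → i ≤ ℓ → WalkIn G S (p ! i) v (ℓ ∸ i)
  suffix p z≤n = p
  suffix (step _ _ p) (s≤s i≤ℓ) = suffix p i≤ℓ

  record Geodesic (S : Subset (n G)) (u v : V) (ℓ : ℕ) : Set where
    field
      walk : WalkIn G S u v ℓ
      shortest : ∀ {k} → k < ℓ → ¬ WalkIn G S u v k

  open Geodesic

  geodesic : WalkIn G S u v ℓ → ∃ (Geodesic S u v)
  geodesic {S} {u} {v} p with minimal-witness (walk? S u v) p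
  ... | d , q , below = d , record { walk = q ; shortest = below }

  geodesic-≤ : Geodesic S u v ℓ → WalkIn G S u v k → ℓ ≤ k
  geodesic-≤ g p = ≮⇒≥ λ k<ℓ → shortest g k<ℓ p

  geodesic-ends-distinct : Geodesic S u v ℓ → 0 < ℓ → u ≢ v
  geodesic-ends-distinct g 0<ℓ refl = shortest g 0<ℓ (here (walk-source (walk g)))

  record IsInducedPath (f : ℕ → V) (L : ℕ) : Set where
    field
      injective : ∀ {i j} → i ≤ L → j ≤ L → f i ≡ f j → i ≡ j
      adjacent : ∀ {i} → i < L → Adj G (f i) (f (suc i))
      chordless : ∀ {i j} → i ≤ L → j ≤ L → Adj G (f i) (f j) → suc i ≡ j ⊎ suc j ≡ i

  module _ {S : Subset (n G)} {u v : V} {ℓ : ℕ} (g : Geodesic S u v ℓ) where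

    geodesic-no-repeat : i < j → j ≤ ℓ → walk g ! i ≢ walk g ! j
    geodesic-no-repeat i<j j≤ℓ eq =
      shortest g (shortcut-shorter i<j j≤ℓ)
        (prefix (walk g) (≤-trans (<⇒≤ i<j) j≤ℓ) ++ʷ
         subst (λ a → WalkIn G S a v _) (≡.sym eq) (suffix (walk g) j≤ℓ))

    geodesic-no-chord : suc i < j → j ≤ ℓ → ¬ Adj G (walk g ! i) (walk g ! j)
    geodesic-no-chord {i} {j} i+1<j j≤ℓ e =
      shortest g (subst (_< ℓ) (≡.sym (+-suc i (ℓ ∸ j))) (shortcut-shorter i+1<j j≤ℓ))
        (prefix (walk g) i≤ℓ ++ʷ step (!-∈ (walk g) i) e (suffix (walk g) j≤ℓ))
      where i≤ℓ = ≤-trans (≤-trans (n≤1+n i) (<⇒≤ i+1<j)) j≤ℓ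

    geodesic-induced : IsInducedPath (walk g !_) ℓ
    geodesic-induced = record { injective = injective ; adjacent = !-adj (walk g) ; chordless = chordless }
      where
        injective : i ≤ ℓ → j ≤ ℓ → walk g ! i ≡ walk g ! j → i ≡ j
        injective {i} {j} i≤ℓ j≤ℓ eq with <-cmp i j
        ... | tri< i<j _ _ = contradiction eq (geodesic-no-repeat i<j j≤ℓ)
        ... | tri≈ _ i≡j _ = i≡j
        ... | tri> _ _ j<i = contradiction (≡.sym eq) (geodesic-no-repeat j<i i≤ℓ)

        chordless : i ≤ ℓ → j ≤ ℓ → Adj G (walk g ! i) (walk g ! j) → suc i ≡ j ⊎ suc j ≡ i
        chordless {i} {j} i≤ℓ j≤ℓ e with <-cmp i j
        ... | tri≈ _ refl _ = contradiction e Adj-irrefl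
        ... | tri< i<j _ _ with m≤n⇒m<n∨m≡n i<j
        ...   | inj₁ i+1<j = contradiction e (geodesic-no-chord i+1<j j≤ℓ)
        ...   | inj₂ i+1≡j = inj₁ i+1≡j
        chordless {i} {j} i≤ℓ j≤ℓ e | tri> _ _ j<i with m≤n⇒m<n∨m≡n j<i
        ...   | inj₁ j+1<i = contradiction (Adj-sym e) (geodesic-no-chord j+1<i i≤ℓ)
        ...   | inj₂ j+1≡i = inj₂ j+1≡i

  avoid-or-reach-earlier : ∀ {x} → v ≢ x → WalkIn G S u v ℓ →
                           WalkIn G (S - x) u v ℓ ⊎ ∃ λ i → i < ℓ × WalkIn G S u x i
  avoid-or-reach-earlier v≢x (here v∈) = inj₁ (here (x∈p∧x≢y⇒x∈p-y v∈ v≢x))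
  avoid-or-reach-earlier {u = u} {x = x} v≢x (step u∈ e p) with u ≟ x
  ... | yes refl = inj₂ (0 , s≤s z≤n , here u∈)
  ... | no u≢x with avoid-or-reach-earlier v≢x p
  ...   | inj₁ q = inj₁ (step (x∈p∧x≢y⇒x∈p-y u∈ u≢x) e q)
  ...   | inj₂ (i , i<ℓ , q) = inj₂ (suc i , s≤s i<ℓ , step u∈ e q)

  record Farthest (S : Subset (n G)) (a : V) : Set where
    field
      vertex : V
      eccentricity : ℕ
      geodesic-to : Geodesic S a vertex eccentricity
      within : ∀ {w} → w ∈ S → ∃ λ k → k ≤ eccentricity × WalkIn G S a w k

  module _ {S : Subset (n G)} {a : V} (connected : ConnectedIn G S) (a∈ : a ∈ S) where

    private
      distance : V → ℕ
      distance w with w ∈? S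
      ... | yes w∈ = proj₁ (geodesic (proj₂ (connected a w a∈ w∈)))
      ... | no _ = 0

      geodesic-of : w ∈ S → Geodesic S a w (distance w)
      geodesic-of {w} w∈ with w ∈? S
      ... | yes w∈′ = proj₂ (geodesic (proj₂ (connected a w a∈ w∈′)))
      ... | no w∉ = contradiction w∈ w∉

    farthest : Farthest S a
    farthest with argmax-over distance (_∈? S) (a , a∈)
    ... | v , v∈ , maximal = record
      { vertex = v
      ; eccentricity = distance v
      ; geodesic-to = geodesic-of v∈
      ; within = λ w∈ → _ , maximal w∈ , walk (geodesic-of w∈)
      }

  -- A cut vertex would force some vertex to be reached through it, hence farther away.
  farthest-not-cut : (F : Farthest S u) → ConnectedIn G (S - Farthest.vertex F)
  farthest-not-cut {S} {u} F w₁ w₂ w₁∈ w₂∈ = _ , walk-reverse (proj₂ (from-u w₁∈)) ++ʷ proj₂ (from-u w₂∈)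
    where
      open Farthest F
      from-u : w ∈ S - vertex → ∃ λ k → WalkIn G (S - vertex) u w k
      from-u w∈ with within (p─q⊆p S _ w∈)
      ... | k , k≤e , p with avoid-or-reach-earlier (x∈p-y⇒x≢y w∈) p
      ...   | inj₁ q = k , q
      ...   | inj₂ (i , i<k , q) = contradiction q (shortest geodesic-to (<-≤-trans i<k k≤e))

  record FarNonCutPair (S : Subset (n G)) (ℓ : ℕ) : Set where
    field
      {start end} : V
      distance : ℕ
      ℓ≤distance : ℓ ≤ distance
      geodesic-between : Geodesic S start end distance
      start-not-cut : ConnectedIn G (S - start)
      end-not-cut : ConnectedIn G (S - end)

  far-non-cut-pair : ConnectedIn G S → Geodesic S u v ℓ → FarNonCutPair S ℓ
  far-non-cut-pair {ℓ = ℓ} connected g with farthest connected (walk-source (walk g))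
  ... | F₁ with farthest connected (walk-target (walk (Farthest.geodesic-to F₁)))
  ... | F₂ = record
    { distance = F₂.eccentricity
    ; ℓ≤distance = ≤-trans ℓ≤D₁ D₁≤D₂
    ; geodesic-between = F₂.geodesic-to
    ; start-not-cut = farthest-not-cut F₁
    ; end-not-cut = farthest-not-cut F₂
    }
    where
      module F₁ = Farthest F₁
      module F₂ = Farthest F₂

      ℓ≤D₁ : ℓ ≤ F₁.eccentricity
      ℓ≤D₁ with F₁.within (walk-target (walk g))
      ... | k , k≤D₁ , p = ≤-trans (geodesic-≤ g p) k≤D₁

      D₁≤D₂ : F₁.eccentricity ≤ F₂.eccentricity
      D₁≤D₂ with F₂.within (walk-source (walk g))
      ... | k , k≤D₂ , p = ≤-trans (geodesic-≤ F₁.geodesic-to (walk-reverse p)) k≤D₂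

  induced-cycle : (h : ℕ → V) {K : ℕ} → 3 ≤ K →
                  (∀ {i j} → i < K → j < K → h i ≡ h j → i ≡ j) →
                  (∀ {i j} → i < K → j < K → Adj G (h i) (h j) → CycNbrℕ K i j) →
                  (∀ {i j} → i < K → j < K → CycNbrℕ K i j → Adj G (h i) (h j)) →
                  InducedCycle G K
  induced-cycle h 3≤K injective adj⇒nbr nbr⇒adj =
      3≤K
    , (λ i → h (toℕ i))
    , (λ eq → toℕ-injective (injective (toℕ<n _) (toℕ<n _) eq))
    , λ i j → adj⇒nbr (toℕ<n i) (toℕ<n j) , nbr⇒adj (toℕ<n i) (toℕ<n j)

  module Glue {f g : ℕ → V} {D m : ℕ} (P : IsInducedPath f D) (Q : IsInducedPath g m)
              (disjoint : ∀ {i j} → i ≤ D → j ≤ m → f i ≢ g j)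
              (cross : ∀ {i j} → i ≤ D → j ≤ m → Adj G (f i) (g j) → (i ≡ D × j ≡ 0) ⊎ (i ≡ 0 × j ≡ m))
              (closeᴰ : Adj G (f D) (g 0)) (close₀ : Adj G (g m) (f 0)) where

    private
      module P = IsInducedPath P
      module Q = IsInducedPath Q

    K : ℕ
    K = suc D + suc m

    glued : ℕ → V
    glued k with k ≤? D
    ... | yes _ = f k
    ... | no _ = g (k ∸ suc D)

    glued-left : i ≤ D → glued i ≡ f i
    glued-left {i} i≤D with i ≤? D
    ... | yes _ = refl
    ... | no i≰D = contradiction i≤D i≰D

    glued-right : ∀ j → glued (suc D + j) ≡ g j
    glued-right j with suc D + j ≤? D
    ... | yes le = contradiction le (<⇒≱ (s≤s (m≤m+n D j)))
    ... | no _ = cong g (m+n∸m≡n (suc D) j)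

    data Side : ℕ → Set where
      left : i ≤ D → Side i
      right : j ≤ m → Side (suc D + j)

    side : k < K → Side k
    side {k} k<K with k ≤? D
    ... | yes k≤D = left k≤D
    ... | no k≰D = subst Side (m+[n∸m]≡n (≰⇒> k≰D)) (right (≤-pred (m<n+o⇒m∸n<o k (suc D) k<K)))

    left-not-last : i ≤ D → suc i ≢ K
    left-not-last i≤D = <⇒≢ (≤-<-trans (s≤s i≤D) (m<m+n (suc D) (s≤s z≤n)))

    shift-suc : suc i ≡ j → suc (suc D + i) ≡ suc D + j
    shift-suc {i} eq = trans (≡.sym (+-suc (suc D) i)) (cong (suc D +_) eq)

    unshift-suc : suc (suc D + i) ≡ suc D + j → suc i ≡ j
    unshift-suc {i} eq = +-cancelˡ-≡ (suc D) _ _ (trans (+-suc (suc D) i) eq)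

    left-left→ : i ≤ D → j ≤ D → Adj G (f i) (f j) → CycNbrℕ K i j
    left-left→ i≤D j≤D e with P.chordless i≤D j≤D e
    ... | inj₁ eq = inj₁ eq
    ... | inj₂ eq = inj₂ (inj₁ eq)

    left-left← : i ≤ D → j ≤ D → CycNbrℕ K i j → Adj G (f i) (f j)
    left-left← _ j≤D (inj₁ refl) = P.adjacent j≤D
    left-left← i≤D _ (inj₂ (inj₁ refl)) = Adj-sym (P.adjacent i≤D)
    left-left← _ j≤D (inj₂ (inj₂ (inj₁ (_ , eq)))) = contradiction eq (left-not-last j≤D)
    left-left← i≤D _ (inj₂ (inj₂ (inj₂ (_ , eq)))) = contradiction eq (left-not-last i≤D)

    right-right→ : i ≤ m → j ≤ m → Adj G (g i) (g j) → CycNbrℕ K (suc D + i) (suc D + j)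
    right-right→ i≤m j≤m e with Q.chordless i≤m j≤m e
    ... | inj₁ eq = inj₁ (shift-suc eq)
    ... | inj₂ eq = inj₂ (inj₁ (shift-suc eq))

    right-right← : i ≤ m → j ≤ m → CycNbrℕ K (suc D + i) (suc D + j) → Adj G (g i) (g j)
    right-right← _ j≤m (inj₁ eq) with unshift-suc eq
    ... | refl = Q.adjacent j≤m
    right-right← i≤m _ (inj₂ (inj₁ eq)) with unshift-suc eq
    ... | refl = Adj-sym (Q.adjacent i≤m)
    right-right← _ _ (inj₂ (inj₂ (inj₁ (() , _))))
    right-right← _ _ (inj₂ (inj₂ (inj₂ (() , _))))

    left-right→ : i ≤ D → j ≤ m → Adj G (f i) (g j) → CycNbrℕ K i (suc D + j)
    left-right→ i≤D j≤m e with cross i≤D j≤m e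
    ... | inj₁ (refl , refl) = inj₁ (cong suc (≡.sym (+-identityʳ D)))
    ... | inj₂ (refl , refl) = inj₂ (inj₂ (inj₁ (refl , ≡.sym (+-suc (suc D) m))))

    left-right← : i ≤ D → j ≤ m → CycNbrℕ K i (suc D + j) → Adj G (f i) (g j)
    left-right← {i} {zero} i≤D _ (inj₁ eq) with suc-injective (trans eq (cong suc (+-identityʳ D)))
    ... | refl = closeᴰ
    left-right← {i} {suc j} i≤D _ (inj₁ eq) =
      contradiction (subst (_≤ D) (suc-injective eq) i≤D) (<⇒≱ (m<m+n D (s≤s z≤n)))
    left-right← i≤D _ (inj₂ (inj₁ refl)) = contradiction i≤D (<⇒≱ (s≤s (≤-trans (m≤m+n D _) (n≤1+n _))))
    left-right← _ _ (inj₂ (inj₂ (inj₁ (refl , eq)))) with suc-injective (unshift-suc eq)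
    ... | refl = Adj-sym close₀
    left-right← _ _ (inj₂ (inj₂ (inj₂ (() , _))))

    glued-injective : i < K → j < K → glued i ≡ glued j → i ≡ j
    glued-injective i<K j<K eq with side i<K | side j<K
    ... | left i≤D | left j≤D =
      P.injective i≤D j≤D (trans (≡.sym (glued-left i≤D)) (trans eq (glued-left j≤D)))
    ... | left i≤D | right {j} j≤m =
      contradiction (trans (≡.sym (glued-left i≤D)) (trans eq (glued-right j))) (disjoint i≤D j≤m)
    ... | right {i} i≤m | left j≤D =
      contradiction (trans (≡.sym (glued-left j≤D)) (trans (≡.sym eq) (glued-right i))) (disjoint j≤D i≤m)
    ... | right {i} i≤m | right {j} j≤m =
      cong (suc D +_) (Q.injective i≤m j≤m (trans (≡.sym (glued-right i)) (trans eq (glued-right j))))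

    glued-adj→ : i < K → j < K → Adj G (glued i) (glued j) → CycNbrℕ K i j
    glued-adj→ i<K j<K e with side i<K | side j<K
    ... | left i≤D | left j≤D =
      left-left→ i≤D j≤D (subst₂ (Adj G) (glued-left i≤D) (glued-left j≤D) e)
    ... | left i≤D | right {j} j≤m =
      left-right→ i≤D j≤m (subst₂ (Adj G) (glued-left i≤D) (glued-right j) e)
    ... | right {i} i≤m | left j≤D =
      CycNbrℕ-sym (left-right→ j≤D i≤m (Adj-sym (subst₂ (Adj G) (glued-right i) (glued-left j≤D) e)))
    ... | right {i} i≤m | right {j} j≤m =
      right-right→ i≤m j≤m (subst₂ (Adj G) (glued-right i) (glued-right j) e)

    glued-adj← : i < K → j < K → CycNbrℕ K i j → Adj G (glued i) (glued j)
    glued-adj← i<K j<K nbr with side i<K | side j<K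
    ... | left i≤D | left j≤D =
      subst₂ (Adj G) (≡.sym (glued-left i≤D)) (≡.sym (glued-left j≤D)) (left-left← i≤D j≤D nbr)
    ... | left i≤D | right {j} j≤m =
      subst₂ (Adj G) (≡.sym (glued-left i≤D)) (≡.sym (glued-right j)) (left-right← i≤D j≤m nbr)
    ... | right {i} i≤m | left j≤D =
      subst₂ (Adj G) (≡.sym (glued-right i)) (≡.sym (glued-left j≤D)) (Adj-sym (left-right← j≤D i≤m (CycNbrℕ-sym nbr)))
    ... | right {i} i≤m | right {j} j≤m =
      subst₂ (Adj G) (≡.sym (glued-right i)) (≡.sym (glued-right j)) (right-right← i≤m j≤m nbr)

    glued-cycle : 1 ≤ D + m → InducedCycle G K
    glued-cycle 1≤D+m = induced-cycle glued 3≤K glued-injective glued-adj→ glued-adj←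
      where 3≤K = s≤s (subst (2 ≤_) (≡.sym (+-suc D m)) (s≤s 1≤D+m))

  module Bridging {S T : Subset (n G)} {A B : V} {D : ℕ} (P : Geodesic S A B D)
                  (disjoint : ∀ {v} → v ∈ S → v ∈ T → ⊥)
                  (attached : ∀ {t s} → t ∈ T → s ∈ S → Adj G t s → s ≡ A ⊎ s ≡ B) where

    Bridge : ℕ → Set
    Bridge m = ∃₂ λ a b → Adj G B a × Adj G b A × WalkIn G T a b m

    NoCommonNeighbour : Set
    NoCommonNeighbour = ∀ {t} → t ∈ T → Adj G B t → Adj G t A → ⊥

    Bridge? : Decidable Bridge
    Bridge? m = any? λ a → any? λ b → Adj? B a ×-dec Adj? b A ×-dec walk? T a b m

    module _ {m : ℕ} {a b : V} (Ba : Adj G B a) (bA : Adj G b A) (q : WalkIn G T a b m)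
             (shortest-bridge : ∀ {j} → j < m → ¬ Bridge j) where

      private
        p = walk P

      bridge-geodesic : Geodesic T a b m
      bridge-geodesic = record { walk = q ; shortest = λ j<m q′ → shortest-bridge j<m (a , b , Ba , bA , q′) }

      touches-B-only-at-start : j ≤ m → Adj G B (q ! j) → j ≡ 0
      touches-B-only-at-start {zero} _ _ = refl
      touches-B-only-at-start {suc j} j≤m Bqⱼ =
        contradiction (q ! suc j , b , Bqⱼ , bA , suffix q j≤m) (shortest-bridge (∸-monoʳ-< (s≤s z≤n) j≤m))

      touches-A-only-at-end : j ≤ m → Adj G (q ! j) A → j ≡ m
      touches-A-only-at-end {j} j≤m qⱼA with m≤n⇒m<n∨m≡n j≤m
      ... | inj₁ j<m = contradiction (a , q ! j , Ba , qⱼA , prefix q j≤m) (shortest-bridge j<m)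
      ... | inj₂ j≡m = j≡m

      cross : i ≤ D → j ≤ m → Adj G (p ! i) (q ! j) → (i ≡ D × j ≡ 0) ⊎ (i ≡ 0 × j ≡ m)
      cross {i} {j} i≤D j≤m e with attached (!-∈ q j) (!-∈ p i) (Adj-sym e)
      ... | inj₁ pᵢ≡A =
        inj₂ ( IsInducedPath.injective (geodesic-induced P) i≤D z≤n pᵢ≡A
             , touches-A-only-at-end j≤m (subst (Adj G (q ! j)) pᵢ≡A (Adj-sym e)))
      ... | inj₂ pᵢ≡B =
        inj₁ ( IsInducedPath.injective (geodesic-induced P) i≤D ≤-refl (trans pᵢ≡B (≡.sym (!-last p)))
             , touches-B-only-at-start j≤m (subst (λ s → Adj G s (q ! j)) pᵢ≡B e))

      bridge-cycle : 1 ≤ D + m → InducedCycle G (suc D + suc m)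
      bridge-cycle = Glue.glued-cycle (geodesic-induced P) (geodesic-induced bridge-geodesic)
        (λ {i} {j} _ _ eq → disjoint (!-∈ p i) (subst (_∈ T) (≡.sym eq) (!-∈ q j)))
        cross
        (subst (λ s → Adj G s a) (≡.sym (!-last p)) Ba)
        (subst (λ t → Adj G t A) (≡.sym (!-last q)) bA)

    bridge-nontrivial : NoCommonNeighbour → ∀ {m} → Bridge m → 1 ≤ m
    bridge-nontrivial _ {suc _} _ = s≤s z≤n
    bridge-nontrivial no-common-neighbour {zero} (_ , _ , Ba , bA , q) with walk-zero q
    ... | refl = ⊥-elim (no-common-neighbour (walk-source q) Ba bA)

    long-cycle : ∃ Bridge → NoCommonNeighbour → ∃ λ k → D + 3 ≤ k × InducedCycle G k
    long-cycle (_ , bridge) no-common-neighbour with minimal-witness Bridge? bridge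
    ... | m , shortest@(_ , _ , Ba , bA , q) , shorter-bridges =
      suc D + suc m , length-bound , bridge-cycle Ba bA q shorter-bridges (≤-trans 1≤m (m≤n+m m D))
      where
        1≤m = bridge-nontrivial no-common-neighbour shortest

        length-bound : D + 3 ≤ suc D + suc m
        length-bound = subst (_≤ suc D + suc m) (≡.sym (+-suc D 2)) (+-monoʳ-≤ (suc D) (s≤s 1≤m))

  AttachedOnlyAt : Subset (n G) → Subset (n G) → V → Set
  AttachedOnlyAt Y X u = ∀ {w w′} → w ∈ Y → w′ ∈ X → Adj G w w′ → w′ ≡ u

  SetsAdjacent-sym : ∀ {X Y} → SetsAdjacent G X Y → SetsAdjacent G Y X
  SetsAdjacent-sym (a , b , a∈ , b∈ , e) = b , a , b∈ , a∈ , Adj-sym e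

  module _ {p : ℕ} {W : Fin p → Subset (n G)} (x : Fin p) (u : V) where

    private
      W′ = updateAt W x (_- u)

    shrink-bag : IsKpStructure G p W → ∀ {v} → v ∈ W x - u → ConnectedIn G (W x - u) →
                 (∀ y → y ≢ x → SetsAdjacent G (W y) (W x - u)) → IsKpStructure G p W′
    shrink-bag (nonempty , disjoint , connected , adjacent) {v} v∈ connected-x adjacent-x =
        nonempty′ , disjoint′ , connected′ , adjacent′
      where
        nonempty′ : ∀ y → ∃ λ w → w ∈ W′ y
        nonempty′ y with updateAt-cases W x (_- u) y
        ... | inj₁ (_ , eq) = v , subst (v ∈_) (≡.sym eq) v∈
        ... | inj₂ (_ , eq) = subst (λ Y → ∃ (_∈ Y)) (≡.sym eq) (nonempty y)

        disjoint′ : ∀ y₁ y₂ → y₁ ≢ y₂ → ∀ w → w ∈ W′ y₁ → w ∈ W′ y₂ → ⊥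
        disjoint′ y₁ y₂ y₁≢y₂ w w∈₁ w∈₂ =
          disjoint y₁ y₂ y₁≢y₂ w (updateAt-shrinks W x y₁ w∈₁) (updateAt-shrinks W x y₂ w∈₂)

        connected′ : ∀ y → ConnectedIn G (W′ y)
        connected′ y with updateAt-cases W x (_- u) y
        ... | inj₁ (_ , eq) = subst (ConnectedIn G) (≡.sym eq) connected-x
        ... | inj₂ (_ , eq) = subst (ConnectedIn G) (≡.sym eq) (connected y)

        adjacent′ : ∀ y₁ y₂ → y₁ ≢ y₂ → SetsAdjacent G (W′ y₁) (W′ y₂)
        adjacent′ y₁ y₂ y₁≢y₂ with updateAt-cases W x (_- u) y₁ | updateAt-cases W x (_- u) y₂
        ... | inj₁ (refl , _) | inj₁ (refl , _) = contradiction refl y₁≢y₂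
        ... | inj₁ (_ , eq₁) | inj₂ (y₂≢x , eq₂) =
          subst₂ (SetsAdjacent G) (≡.sym eq₁) (≡.sym eq₂) (SetsAdjacent-sym (adjacent-x y₂ y₂≢x))
        ... | inj₂ (y₁≢x , eq₁) | inj₁ (_ , eq₂) =
          subst₂ (SetsAdjacent G) (≡.sym eq₁) (≡.sym eq₂) (adjacent-x y₁ y₁≢x)
        ... | inj₂ (_ , eq₁) | inj₂ (_ , eq₂) =
          subst₂ (SetsAdjacent G) (≡.sym eq₁) (≡.sym eq₂) (adjacent y₁ y₂ y₁≢y₂)

  -- Otherwise W x - u could replace W x, contradicting minimality.
  private-bag : ∀ {p W} → IsMinimalKpStructure G p W → ∀ x {u v} → u ∈ W x → v ∈ W x - u →
                ConnectedIn G (W x - u) → ∃ λ y → y ≢ x × AttachedOnlyAt (W y) (W x) u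
  private-bag {p} {W} (str , minimal) x {u} u∈ v∈ connected-x
    with all? (λ y → ¬? (y ≟ x) →-dec SetsAdjacent? (W y) (W x - u))
  ... | yes all-adjacent =
    ⊥-elim (minimal _ (shrink-bag x u str v∈ connected-x all-adjacent) (λ y → updateAt-shrinks W x y)
                    (x , subst (_⊂ W x) (≡.sym (updateAt-updates x W)) (x∈p⇒p-x⊂p u∈)))
  ... | no not-all with ¬∀⟶∃¬ p _ (λ y → ¬? (y ≟ x) →-dec SetsAdjacent? (W y) (W x - u)) not-all
  ... | y , not-adjacent = y , (λ y≡x → not-adjacent λ y≢x → contradiction y≡x y≢x) , attached
    where
      attached : AttachedOnlyAt (W y) (W x) u
      attached {w} {w′} w∈ w′∈ e with w′ ≟ u
      ... | yes w′≡u = w′≡u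
      ... | no w′≢u = contradiction (λ _ → w , w′ , w∈ , x∈p∧x≢y⇒x∈p-y w′∈ w′≢u , e) not-adjacent

  bag-cycle : ∀ {p W} → IsKpStructure G p W → ∀ {x y z : Fin p} → y ≢ x → z ≢ x → y ≢ z →
              ∀ {A B D} → Geodesic (W x) A B D → A ≢ B →
              AttachedOnlyAt (W y) (W x) A → AttachedOnlyAt (W z) (W x) B →
              ∃ λ k → D + 3 ≤ k × InducedCycle G k
  bag-cycle {W = W} (_ , disjoint , connected , adjacent) {x} {y} {z} y≢x z≢x y≢z {A} {B} P A≢B at-A at-B =
    Bridging.long-cycle P apart attached bridge no-common-neighbour
    where
      Y∪Z = W y ∪ W z

      y⊆Y∪Z : W y ⊆ Y∪Z
      y⊆Y∪Z v∈ = x∈p∪q⁺ (inj₁ v∈)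

      z⊆Y∪Z : W z ⊆ Y∪Z
      z⊆Y∪Z v∈ = x∈p∪q⁺ {p = W y} (inj₂ v∈)

      apart : ∀ {v} → v ∈ W x → v ∈ Y∪Z → ⊥
      apart {v} v∈x v∈Y∪Z with x∈p∪q⁻ (W y) (W z) v∈Y∪Z
      ... | inj₁ v∈y = disjoint x y (λ x≡y → y≢x (≡.sym x≡y)) v v∈x v∈y
      ... | inj₂ v∈z = disjoint x z (λ x≡z → z≢x (≡.sym x≡z)) v v∈x v∈z

      attached : ∀ {t s} → t ∈ Y∪Z → s ∈ W x → Adj G t s → s ≡ A ⊎ s ≡ B
      attached t∈Y∪Z s∈ e with x∈p∪q⁻ (W y) (W z) t∈Y∪Z
      ... | inj₁ t∈y = inj₁ (at-A t∈y s∈ e)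
      ... | inj₂ t∈z = inj₂ (at-B t∈z s∈ e)

      no-common-neighbour : Bridging.NoCommonNeighbour P apart attached
      no-common-neighbour t∈Y∪Z Bt tA with x∈p∪q⁻ (W y) (W z) t∈Y∪Z
      ... | inj₁ t∈y = A≢B (≡.sym (at-A t∈y (walk-target (walk P)) (Adj-sym Bt)))
      ... | inj₂ t∈z = A≢B (at-B t∈z (walk-source (walk P)) tA)

      bridge : ∃ (Bridging.Bridge P apart attached)
      bridge with adjacent z x z≢x | adjacent y x y≢x | adjacent z y (λ z≡y → y≢z (≡.sym z≡y))
      ... | a , s , a∈ , s∈ , as | b , s′ , b∈ , s′∈ , bs′ | c , d , c∈ , d∈ , cd =
        _ , a , b ,
        Adj-sym (subst (Adj G a) (at-B a∈ s∈ as) as) ,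
        subst (Adj G b) (at-A b∈ s′∈ bs′) bs′ ,
        walk-mono z⊆Y∪Z (proj₂ (connected z a c a∈ c∈)) ++ʷ
        step (z⊆Y∪Z c∈) cd (walk-mono y⊆Y∪Z (proj₂ (connected y d b d∈ b∈)))

  non-cut-ends-cycle : ∀ {p W} → IsMinimalKpStructure G p W → ∀ x {a b D} → Geodesic (W x) a b D → 0 < D →
                       ConnectedIn G (W x - a) → ConnectedIn G (W x - b) →
                       ∃ λ k → D + 3 ≤ k × InducedCycle G k
  non-cut-ends-cycle minimal@(str@(_ , _ , _ , adjacent) , _) x P 0<D a-not-cut b-not-cut
    with private-bag minimal x a∈ (x∈p∧x≢y⇒x∈p-y b∈ (λ b≡a → a≢b (≡.sym b≡a))) a-not-cut
       | private-bag minimal x b∈ (x∈p∧x≢y⇒x∈p-y a∈ a≢b) b-not-cut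
    where
      a∈ = walk-source (walk P)
      b∈ = walk-target (walk P)
      a≢b = geodesic-ends-distinct P 0<D
  ... | y , y≢x , at-a | z , z≢x , at-b = bag-cycle str y≢x z≢x y≢z P a≢b at-a at-b
    where
      a≢b = geodesic-ends-distinct P 0<D

      y≢z : y ≢ z
      y≢z refl with adjacent y x y≢x
      ... | _ , _ , w∈ , w′∈ , e = a≢b (trans (≡.sym (at-a w∈ w′∈ e)) (at-b w∈ w′∈ e))

  bag-geodesic-bound : ∀ {c p W} → IsChordality G c → IsMinimalKpStructure G p W →
                       ∀ x {u v d} → Geodesic (W x) u v d → d ≤ c ∸ 3
  bag-geodesic-bound _ _ _ {d = zero} _ = z≤n
  bag-geodesic-bound (longest , _) minimal@((_ , _ , connected , _) , _) x {d = suc d} g =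
    let open FarNonCutPair (far-non-cut-pair (connected x) g)
        (k , D+3≤k , cycle) = non-cut-ends-cycle minimal x geodesic-between (≤-trans (s≤s z≤n) ℓ≤distance)
                                                 start-not-cut end-not-cut
    in m+n≤o⇒m≤o∸n (suc d) (≤-trans (+-monoˡ-≤ 3 ℓ≤distance) (≤-trans D+3≤k (longest k cycle)))

lemma3 : (G : Graph) (p : ℕ) (W : Fin p → Subset (n G)) (c : ℕ) →
    IsChordality G c → IsMinimalKpStructure G p W →
    ∀ x → DiameterIn≤ G (W x) (c ∸ 3)
lemma3 G p W c chordality minimal@((_ , _ , connected , _) , _) x u v u∈ v∈ =
  let open InGraph G
      (d , g) = geodesic (proj₂ (connected x u v u∈ v∈))
  in d , bag-geodesic-bound chordality minimal x g , Geodesic.walk g
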